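{- For every $n\ge 1$, $\mathrm{thin}_{ind}(CR_n)=\mathrm{pthin}_{ind}(CR_n)=n$.
   Context: The crown graph $CR_n$ is obtained from $K_{n,n}$ by removing a perfect matching. An ordering $<$ of $V(G)$ is consistent with a partition $\mathcal{V}$ if for every $p<q<r$ with $p,q$ in the same class and $pr\in E(G)$, also $qr\in E(G)$; strongly consistent if both $<$ and its reversal are consistent. The independent thinness $\mathrm{thin}_{ind}(G)$ (resp. independent proper thinness $\mathrm{pthin}_{ind}(G)$) is the minimum $k$ such that $V(G)$ has a partition into $k$ independent sets and an ordering consistent (resp. strongly consistent) with it. -}

module Defs where

open import Data.Nat using (ℕ; _≤_)
open import Data.Fin using (Fin; splitAt; _<_)
open import Data.Fin.Permutation using (Permutation′; _⟨$⟩ʳ_)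
open import Data.Sum using (_⊎_; inj₁; inj₂)
open import Data.Product using (Σ; _×_; ∃₂)
open import Data.Empty using (⊥)
open import Relation.Nullary using (¬_)
open import Relation.Binary.PropositionalEquality using (_≡_)

record Graph : Set₁ where
  field
    N     : ℕ
    Adj   : Fin N → Fin N → Set
    sym   : ∀ {u v} → Adj u v → Adj v u
    irrefl : ∀ {v} → ¬ Adj v v
open Graph public

-- Crown graph CR_n: vertices Fin (n + n); the first n vertices are
-- a_0..a_{n-1}, the last n are b_0..b_{n-1}; a_i ~ b_j iff i ≢ j.
CRAdj' : ∀ {n} → Fin n ⊎ Fin n → Fin n ⊎ Fin n → Set
CRAdj' (inj₁ i) (inj₂ j) = ¬ (i ≡ j)
CRAdj' (inj₂ i) (inj₁ j) = ¬ (i ≡ j)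
CRAdj' (inj₁ _) (inj₁ _) = ⊥
CRAdj' (inj₂ _) (inj₂ _) = ⊥

CRAdj : ∀ n → Fin (n Data.Nat.+ n) → Fin (n Data.Nat.+ n) → Set
CRAdj n u v = CRAdj' (splitAt n u) (splitAt n v)

CRsym' : ∀ {n} (x y : Fin n ⊎ Fin n) → CRAdj' x y → CRAdj' y x
CRsym' (inj₁ i) (inj₂ j) h e = h (Relation.Binary.PropositionalEquality.sym e)
CRsym' (inj₂ i) (inj₁ j) h e = h (Relation.Binary.PropositionalEquality.sym e)

CRirr' : ∀ {n} (x : Fin n ⊎ Fin n) → ¬ CRAdj' x x
CRirr' (inj₁ _) ()
CRirr' (inj₂ _) ()

Crown : ℕ → Graph
Crown n = record
  { N = n Data.Nat.+ n
  ; Adj = CRAdj n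
  ; sym = λ {u} {v} → CRsym' (splitAt n u) (splitAt n v)
  ; irrefl = λ {v} → CRirr' (splitAt n v)
  }

-- A partition of V(G) into (at most) k classes is given by a class map
-- V(G) → Fin k; a linear ordering of V(G) is a permutation giving each
-- vertex its position.
Partition : Graph → ℕ → Set
Partition G k = Fin (N G) → Fin k

Ordering : Graph → Set
Ordering G = Permutation′ (N G)

Independent : (G : Graph) {k : ℕ} → Partition G k → Set
Independent G c = ∀ u v → c u ≡ c v → ¬ Adj G u v

pos : {G : Graph} → Ordering G → Fin (N G) → Fin (N G)
pos π v = π ⟨$⟩ʳ v

Consistent : (G : Graph) {k : ℕ} → Ordering G → Partition G k → Set
Consistent G π c = ∀ p q r → pos {G} π p < pos {G} π q → pos {G} π q < pos {G} π r →
  c p ≡ c q → Adj G p r → Adj G q r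

ReverseConsistent : (G : Graph) {k : ℕ} → Ordering G → Partition G k → Set
ReverseConsistent G π c = ∀ p q r → pos {G} π r < pos {G} π q → pos {G} π q < pos {G} π p →
  c p ≡ c q → Adj G p r → Adj G q r

StronglyConsistent : (G : Graph) {k : ℕ} → Ordering G → Partition G k → Set
StronglyConsistent G π c = Consistent G π c × ReverseConsistent G π c

IndThinWith : Graph → ℕ → Set
IndThinWith G k = Σ (Partition G k) λ c → Σ (Ordering G) λ π →
  Independent G c × Consistent G π c

IndPThinWith : Graph → ℕ → Set
IndPThinWith G k = Σ (Partition G k) λ c → Σ (Ordering G) λ π →
  Independent G c × StronglyConsistent G π c

ThinInd≡ : Graph → ℕ → Set
ThinInd≡ G m = IndThinWith G m × (∀ k → IndThinWith G k → m ≤ k)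

PThinInd≡ : Graph → ℕ → Set
PThinInd≡ G m = IndPThinWith G m × (∀ k → IndPThinWith G k → m ≤ k)

{-# OPTIONS --safe #-}
module Submission where

-- Lower bound: for each i let eᵢ be whichever of aᵢ, bᵢ comes first. Two of
-- the eᵢ in one class cannot lie on different sides, as they would be adjacent;
-- and if aᵢ < aⱼ are both first in their pairs, then aᵢ < aⱼ < bⱼ with aᵢ ~ bⱼ,
-- so consistency forces aⱼ ~ bⱼ. Hence i ↦ class of eᵢ is injective.
--
-- Upper bound: with i' = n - 1 - i, put aᵢ in class min(i, i') and bᵢ in class
-- max(i, i'), and order the vertices so that aᵢ is in the first half iff i ≤ i'
-- and bᵢ is in the other half from aᵢ. In a class {x, y} on one side, the only
-- vertex adjacent to x but not to y is the partner of y, which lies in the same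
-- half as x, so y never separates them. Reversing the first half makes aₘ the
-- first a and bₘ the last b for the centre m = m', which settles the class
-- {aₘ, bₘ} when n is odd.

open import Defs hiding (sym)
open import Data.Bool using (Bool; true; false; not; if_then_else_)
open import Data.Bool.Properties using (if-float; not-¬; not-injective)
open import Data.Empty using (⊥; ⊥-elim)
open import Data.Fin using (Fin; toℕ; _↑ˡ_; _↑ʳ_; splitAt; join; opposite; _<_; _≤_; _≟_; _≤?_)
open import Data.Fin.Permutation using (Permutation′; permutation; _∘ₚ_)
open import Data.Fin.Properties
  using (splitAt-↑ˡ; splitAt-↑ʳ; splitAt⁻¹-↑ˡ; splitAt⁻¹-↑ʳ; splitAt-join; join-splitAt;
         toℕ-↑ˡ; toℕ-↑ʳ; toℕ<n; ↑ˡ-injective; ↑ʳ-injective; <-cmp; ≤-antisym; ≤-reflexive;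
         opposite-prop; opposite-involutive; injective⇒≤)
open import Data.Nat as ℕ using (ℕ; _+_; _≥_; s≤s)
open import Data.Nat.Properties
  using (module ≤-Reasoning; ∸-monoʳ-<; ≰⇒>; <-irrefl; <-asym; m≤m+n; +-cancelˡ-<)
open import Data.Product using (_×_; _,_; proj₁; proj₂; ∃₂)
open import Data.Sum using (_⊎_; inj₁; inj₂; [_,_]′; map₁)
open import Function using (_∘_; id; const; Injection)
open import Function.Properties.Inverse using (↔⇒↣)
open import Relation.Binary.Definitions using (tri<; tri≈; tri>)
open import Relation.Binary.PropositionalEquality
  using (_≡_; _≢_; refl; sym; trans; cong; cong₂; subst; subst₂; module ≡-Reasoning)
open import Relation.Nullary using (¬_; yes; no; does; proof; contradiction)
open import Relation.Nullary.Decidable using (dec-true)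
open import Relation.Nullary.Reflects using (Reflects; invert)

Between : ∀ {m} → Fin m → Fin m → Fin m → Set
Between x y z = (x < y × y < z) ⊎ (z < y × y < x)

module _ (G : Graph) {k : ℕ} (c : Partition G k) (π : Ordering G) where

  private
    position : Fin (N G) → Fin (N G)
    position = pos {G} π

  strongly-consistent-between :
    (∀ p q r → Between (position p) (position q) (position r) →
               c p ≡ c q → Adj G p r → Adj G q r) →
    StronglyConsistent G π c
  strongly-consistent-between h =
    (λ p q r p<q q<r → h p q r (inj₁ (p<q , q<r))) ,
    (λ p q r r<q q<p → h p q r (inj₂ (r<q , q<p)))

  crossed-pair-inconsistent : Consistent G π c → ∀ {x x' y y'} → x ≢ y → c x ≡ c y →
    Adj G x y' → Adj G y x' → ¬ Adj G x x' → ¬ Adj G y y' →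
    position x < position x' → position y < position y' → ⊥
  crossed-pair-inconsistent cons {x} {x'} {y} {y'} x≢y cxy xy' yx' ¬xx' ¬yy' x<x' y<y'
    with <-cmp (position x) (position y)
  ... | tri< x<y _ _ = ¬yy' (cons x y y' x<y y<y' cxy xy')
  ... | tri≈ _ x≡y _ = x≢y (Injection.injective (↔⇒↣ π) x≡y)
  ... | tri> _ _ y<x = ¬xx' (cons y x x' y<x x<x' (sym cxy) yx')

opposite-< : ∀ {m} {i j : Fin m} → i < j → opposite j < opposite i
opposite-< {m} {i} {j} i<j = subst₂ ℕ._<_ (sym (opposite-prop j)) (sym (opposite-prop i))
  (∸-monoʳ-< (s≤s i<j) (toℕ<n j))

opposite-<⁻¹ : ∀ {m} {i j : Fin m} → opposite i < opposite j → j < i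
opposite-<⁻¹ {m} {i} {j} = subst₂ _<_ (opposite-involutive j) (opposite-involutive i) ∘ opposite-<

opposite-injective : ∀ {m} {i j : Fin m} → opposite i ≡ opposite j → i ≡ j
opposite-injective {m} {i} {j} e =
  trans (sym (opposite-involutive i)) (trans (cong opposite e) (opposite-involutive j))

halvesInvolution : ∀ {m} (f : Fin m ⊎ Fin m → Fin m ⊎ Fin m) →
                   (∀ x → f (f x) ≡ x) → Permutation′ (m + m)
halvesInvolution {m} f f-involutive = permutation g g g-involutive g-involutive
  where
  g : Fin (m + m) → Fin (m + m)
  g = join m m ∘ f ∘ splitAt m

  g-involutive : ∀ v → g (g v) ≡ v
  g-involutive v = begin
    join m m (f (splitAt m (join m m (f (splitAt m v))))) ≡⟨ cong (join m m ∘ f) (splitAt-join m m _) ⟩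
    join m m (f (f (splitAt m v)))                        ≡⟨ cong (join m m) (f-involutive _) ⟩
    join m m (splitAt m v)                                ≡⟨ join-splitAt m m v ⟩
    v                                                     ∎
    where open ≡-Reasoning

module CrownProperties (n : ℕ) where

  a b : Fin n → Fin (n + n)
  a i = i ↑ˡ n
  b i = n ↑ʳ i

  data View : Fin (n + n) → Set where
    a-view : ∀ i → View (a i)
    b-view : ∀ i → View (b i)

  view : ∀ v → View v
  view v with splitAt n v in eq
  ... | inj₁ i = subst View (splitAt⁻¹-↑ˡ eq) (a-view i)
  ... | inj₂ i = subst View (splitAt⁻¹-↑ʳ eq) (b-view i)

  sides : {X : Set} → (Fin n → X) → (Fin n → X) → Fin (n + n) → X
  sides f g = [ f , g ]′ ∘ splitAt n

  sides-a : ∀ {X : Set} {f g : Fin n → X} i → sides f g (a i) ≡ f i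
  sides-a {f = f} {g} i = cong [ f , g ]′ (splitAt-↑ˡ n i n)

  sides-b : ∀ {X : Set} {f g : Fin n → X} i → sides f g (b i) ≡ g i
  sides-b {f = f} {g} i = cong [ f , g ]′ (splitAt-↑ʳ n n i)

  a≢b : ∀ {i j} → a i ≢ b j
  a≢b {i} {j} e with trans (sym (splitAt-↑ˡ n i n)) (trans (cong (splitAt n) e) (splitAt-↑ʳ n n j))
  ... | ()

  b≮a : ∀ {i j} → ¬ b i < a j
  b≮a {i} {j} b<a = <-irrefl refl (begin-strict
    n           ≤⟨ m≤m+n n (toℕ i) ⟩
    n + toℕ i   ≡⟨ toℕ-↑ʳ n i ⟨
    toℕ (b i)   <⟨ b<a ⟩
    toℕ (a j)   ≡⟨ toℕ-↑ˡ j n ⟩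
    toℕ j       <⟨ toℕ<n j ⟩
    n           ∎)
    where open ≤-Reasoning

  a<a⇒< : ∀ {i j} → a i < a j → i < j
  a<a⇒< {i} {j} = subst₂ ℕ._<_ (toℕ-↑ˡ i n) (toℕ-↑ˡ j n)

  b<b⇒< : ∀ {i j} → b i < b j → i < j
  b<b⇒< {i} {j} = +-cancelˡ-< n (toℕ i) (toℕ j) ∘ subst₂ ℕ._<_ (toℕ-↑ʳ n i) (toℕ-↑ʳ n j)

  ab-edge : ∀ {i j} → i ≢ j → Adj (Crown n) (a i) (b j)
  ab-edge {i} {j} = subst id (sym (cong₂ CRAdj' (splitAt-↑ˡ n i n) (splitAt-↑ʳ n n j)))

  ab-edge⁻¹ : ∀ {i j} → Adj (Crown n) (a i) (b j) → i ≢ j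
  ab-edge⁻¹ {i} {j} = subst id (cong₂ CRAdj' (splitAt-↑ˡ n i n) (splitAt-↑ʳ n n j))

  ba-edge : ∀ {i j} → i ≢ j → Adj (Crown n) (b i) (a j)
  ba-edge {i} {j} = subst id (sym (cong₂ CRAdj' (splitAt-↑ʳ n n i) (splitAt-↑ˡ n j n)))

  ba-edge⁻¹ : ∀ {i j} → Adj (Crown n) (b i) (a j) → i ≢ j
  ba-edge⁻¹ {i} {j} = subst id (cong₂ CRAdj' (splitAt-↑ʳ n n i) (splitAt-↑ˡ n j n))

  aa-non-edge : ∀ {i j} → ¬ Adj (Crown n) (a i) (a j)
  aa-non-edge {i} {j} = subst id (cong₂ CRAdj' (splitAt-↑ˡ n i n) (splitAt-↑ˡ n j n))

  bb-non-edge : ∀ {i j} → ¬ Adj (Crown n) (b i) (b j)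
  bb-non-edge {i} {j} = subst id (cong₂ CRAdj' (splitAt-↑ʳ n n i) (splitAt-↑ʳ n n j))

  module _ {k : ℕ} (c : Partition (Crown n) k) (π : Ordering (Crown n)) where

    private
      position : Fin (n + n) → Fin (n + n)
      position = pos {Crown n} π

    data Earlier (i : Fin n) : Fin (n + n) → Fin (n + n) → Set where
      a-first : position (a i) < position (b i) → Earlier i (a i) (b i)
      b-first : position (b i) < position (a i) → Earlier i (b i) (a i)

    earlier : ∀ i → ∃₂ (Earlier i)
    earlier i with <-cmp (position (a i)) (position (b i))
    ... | tri< a<b _ _ = _ , _ , a-first a<b
    ... | tri≈ _ a≡b _ = ⊥-elim (a≢b (Injection.injective (↔⇒↣ π) a≡b))
    ... | tri> _ _ b<a = _ , _ , b-first b<a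

    earlier-same-class-impossible : Independent (Crown n) c → Consistent (Crown n) π c →
      ∀ {i j x x' y y'} → i ≢ j → Earlier i x x' → Earlier j y y' → c x ≡ c y → ⊥
    earlier-same-class-impossible _ cons i≢j (a-first x<x') (a-first y<y') cxy =
      crossed-pair-inconsistent (Crown n) c π cons (i≢j ∘ ↑ˡ-injective n _ _) cxy
        (ab-edge i≢j) (ab-edge (i≢j ∘ sym)) (λ e → ab-edge⁻¹ e refl) (λ e → ab-edge⁻¹ e refl)
        x<x' y<y'
    earlier-same-class-impossible _ cons i≢j (b-first x<x') (b-first y<y') cxy =
      crossed-pair-inconsistent (Crown n) c π cons (i≢j ∘ ↑ʳ-injective n _ _) cxy
        (ba-edge i≢j) (ba-edge (i≢j ∘ sym)) (λ e → ba-edge⁻¹ e refl) (λ e → ba-edge⁻¹ e refl)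
        x<x' y<y'
    earlier-same-class-impossible ind _ i≢j (a-first _) (b-first _) cxy = ind _ _ cxy (ab-edge i≢j)
    earlier-same-class-impossible ind _ i≢j (b-first _) (a-first _) cxy = ind _ _ cxy (ba-edge i≢j)

    earlier-class-injective : Independent (Crown n) c → Consistent (Crown n) π c →
      ∀ {i j} → c (proj₁ (earlier i)) ≡ c (proj₁ (earlier j)) → i ≡ j
    earlier-class-injective ind cons {i} {j} cij with i ≟ j
    ... | yes i≡j = i≡j
    ... | no i≢j = ⊥-elim (earlier-same-class-impossible ind cons i≢j
                             (proj₂ (proj₂ (earlier i))) (proj₂ (proj₂ (earlier j))) cij)

  thin-lower-bound : ∀ {k} → IndThinWith (Crown n) k → n ℕ.≤ k
  thin-lower-bound (c , π , ind , cons) = injective⇒≤ (earlier-class-injective c π ind cons)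

  pthin-lower-bound : ∀ {k} → IndPThinWith (Crown n) k → n ℕ.≤ k
  pthin-lower-bound (c , π , ind , cons , _) = thin-lower-bound (c , π , ind , cons)

  low : Fin n → Bool
  low i = does (i ≤? opposite i)

  low⇒≤ : ∀ {i} → low i ≡ true → i ≤ opposite i
  low⇒≤ {i} e = invert (subst (Reflects _) e (proof (i ≤? opposite i)))

  high⇒> : ∀ {i} → low i ≡ false → opposite i < i
  high⇒> {i} e = ≰⇒> (invert (subst (Reflects _) e (proof (i ≤? opposite i))))

  centre-low : ∀ {m} → opposite m ≡ m → low m ≡ true
  centre-low {m} centre = dec-true (m ≤? opposite m) (≤-reflexive (sym centre))

  low-≤-centre : ∀ {m l} → opposite m ≡ m → low l ≡ true → ¬ m < l
  low-≤-centre {m} {l} centre low-l m<l = <-irrefl refl (begin-strict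
    toℕ (opposite l)   <⟨ opposite-< m<l ⟩
    toℕ (opposite m)   ≡⟨ cong toℕ centre ⟩
    toℕ m              <⟨ m<l ⟩
    toℕ l              ≤⟨ low⇒≤ low-l ⟩
    toℕ (opposite l)   ∎)
    where open ≤-Reasoning

  lower : Fin n → Fin n
  lower i = if low i then i else opposite i

  lower-injective : ∀ {i j} → low i ≡ low j → lower i ≡ lower j → i ≡ j
  lower-injective {i} {j} same-low e with low i | low j
  ... | true  | true  = e
  ... | false | false = opposite-injective e
  lower-injective () _ | true | false
  lower-injective () _ | false | true

  lower≡opposite-lower : ∀ {i j} → lower i ≡ opposite (lower j) → i ≡ j × opposite i ≡ i
  lower≡opposite-lower {i} {j} e with low i in li | low j in lj
  ... | true | true = i≡j , trans i'≡j (sym i≡j)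
    where
    i'≡j : opposite i ≡ j
    i'≡j = trans (cong opposite e) (opposite-involutive j)
    i≡j : i ≡ j
    i≡j = ≤-antisym (subst (i ≤_) i'≡j (low⇒≤ li)) (subst (j ≤_) (sym e) (low⇒≤ lj))
  ... | true | false =
    contradiction (trans (sym li) (trans (cong low (trans e (opposite-involutive j))) lj)) λ ()
  ... | false | true = contradiction (trans (sym li) (trans (cong low (opposite-injective e)) lj)) λ ()
  ... | false | false = ⊥-elim (<-asym (high⇒> li) (subst₂ _<_ j'≡i (sym i'≡j) (high⇒> lj)))
    where
    i'≡j : opposite i ≡ j
    i'≡j = trans e (opposite-involutive j)
    j'≡i : opposite j ≡ i
    j'≡i = trans (cong opposite (sym i'≡j)) (opposite-involutive i)

  classes : Partition (Crown n) n
  classes = sides lower (opposite ∘ lower)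

  same-class-aa : ∀ {i j} → classes (a i) ≡ classes (a j) → i ≢ j → low i ≢ low j
  same-class-aa {i} {j} e i≢j same-low =
    i≢j (lower-injective same-low (trans (sym (sides-a i)) (trans e (sides-a j))))

  same-class-bb : ∀ {i j} → classes (b i) ≡ classes (b j) → i ≢ j → low i ≢ low j
  same-class-bb {i} {j} e i≢j same-low =
    i≢j (lower-injective same-low (opposite-injective (trans (sym (sides-b i)) (trans e (sides-b j)))))

  same-class-ab : ∀ {i j} → classes (a i) ≡ classes (b j) → i ≡ j × opposite i ≡ i
  same-class-ab {i} {j} e = lower≡opposite-lower (trans (sym (sides-a i)) (trans e (sides-b j)))

  classes-independent : Independent (Crown n) classes
  classes-independent u v e with view u | view v
  ... | a-view i | a-view j = aa-non-edge
  ... | b-view i | b-view j = bb-non-edge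
  ... | a-view i | b-view j with refl , _ ← same-class-ab e = λ adj → ab-edge⁻¹ adj refl
  ... | b-view i | a-view j with refl , _ ← same-class-ab (sym e) = λ adj → ba-edge⁻¹ adj refl

  swapHigh : Fin n ⊎ Fin n → Fin n ⊎ Fin n
  swapHigh (inj₁ i) = if low i then inj₁ i else inj₂ i
  swapHigh (inj₂ i) = if low i then inj₂ i else inj₁ i

  swapHigh-involutive : ∀ x → swapHigh (swapHigh x) ≡ x
  swapHigh-involutive (inj₁ i) with low i in li
  ... | true  rewrite li = refl
  ... | false rewrite li = refl
  swapHigh-involutive (inj₂ i) with low i in li
  ... | true  rewrite li = refl
  ... | false rewrite li = refl

  reverseFirst : Fin n ⊎ Fin n → Fin n ⊎ Fin n
  reverseFirst = map₁ opposite

  reverseFirst-involutive : ∀ x → reverseFirst (reverseFirst x) ≡ x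
  reverseFirst-involutive (inj₁ i) = cong inj₁ (opposite-involutive i)
  reverseFirst-involutive (inj₂ i) = refl

  ordering : Ordering (Crown n)
  ordering = halvesInvolution swapHigh swapHigh-involutive
          ∘ₚ halvesInvolution reverseFirst reverseFirst-involutive

  position : Fin (n + n) → Fin (n + n)
  position = pos {Crown n} ordering

  position-sides : ∀ v → position v ≡ join n n (reverseFirst (swapHigh (splitAt n v)))
  position-sides v = cong (join n n ∘ reverseFirst) (splitAt-join n n (swapHigh (splitAt n v)))

  position-a : ∀ i → position (a i) ≡ (if low i then a (opposite i) else b i)
  position-a i = trans (position-sides (a i)) (trans
    (cong (join n n ∘ reverseFirst ∘ swapHigh) (splitAt-↑ˡ n i n))
    (if-float (join n n ∘ reverseFirst) (low i)))

  position-b : ∀ i → position (b i) ≡ (if low i then b i else a (opposite i))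
  position-b i = trans (position-sides (b i)) (trans
    (cong (join n n ∘ reverseFirst ∘ swapHigh) (splitAt-↑ʳ n n i))
    (if-float (join n n ∘ reverseFirst) (low i)))

  firstHalf : Fin (n + n) → Bool
  firstHalf = sides (const true) (const false)

  firstHalf-position-a : ∀ i → firstHalf (position (a i)) ≡ low i
  firstHalf-position-a i rewrite position-a i with low i
  ... | true  = sides-a (opposite i)
  ... | false = sides-b i

  firstHalf-position-b : ∀ i → firstHalf (position (b i)) ≡ not (low i)
  firstHalf-position-b i rewrite position-b i with low i
  ... | true  = sides-b i
  ... | false = sides-a (opposite i)

  halves-ordered : ∀ {x y z} → firstHalf x ≢ firstHalf y → firstHalf z ≢ firstHalf y →
                   x < y → y < z → ⊥
  halves-ordered {x} {y} {z} x≁y z≁y x<y y<z with view x | view y | view z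
  ... | a-view p | a-view q | _        = x≁y (trans (sides-a p) (sym (sides-a q)))
  ... | b-view p | a-view q | _        = b≮a x<y
  ... | _        | b-view q | a-view r = b≮a y<z
  ... | _        | b-view q | b-view r = z≁y (trans (sides-b r) (sym (sides-b q)))

  halves-separate : ∀ {x y z} → firstHalf x ≢ firstHalf y → firstHalf z ≢ firstHalf y →
                    ¬ Between x y z
  halves-separate x≁y z≁y (inj₁ (x<y , y<z)) = halves-ordered x≁y z≁y x<y y<z
  halves-separate x≁y z≁y (inj₂ (z<y , y<x)) = halves-ordered z≁y x≁y z<y y<x

  aa-class-separated : ∀ {i j} → classes (a i) ≡ classes (a j) → i ≢ j →
                       ¬ Between (position (a i)) (position (a j)) (position (b j))
  aa-class-separated {i} {j} e i≢j = halves-separate ai≁aj bj≁aj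
    where
    ai≁aj : firstHalf (position (a i)) ≢ firstHalf (position (a j))
    ai≁aj rewrite firstHalf-position-a i | firstHalf-position-a j = same-class-aa e i≢j
    bj≁aj : firstHalf (position (b j)) ≢ firstHalf (position (a j))
    bj≁aj rewrite firstHalf-position-b j | firstHalf-position-a j = not-¬ refl ∘ sym

  bb-class-separated : ∀ {i j} → classes (b i) ≡ classes (b j) → i ≢ j →
                       ¬ Between (position (b i)) (position (b j)) (position (a j))
  bb-class-separated {i} {j} e i≢j = halves-separate bi≁bj aj≁bj
    where
    bi≁bj : firstHalf (position (b i)) ≢ firstHalf (position (b j))
    bi≁bj rewrite firstHalf-position-b i | firstHalf-position-b j =
      same-class-bb e i≢j ∘ not-injective
    aj≁bj : firstHalf (position (a j)) ≢ firstHalf (position (b j))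
    aj≁bj rewrite firstHalf-position-a j | firstHalf-position-b j = not-¬ refl

  centre-a-before-b : ∀ {m} → opposite m ≡ m → ¬ position (b m) < position (a m)
  centre-a-before-b {m} centre rewrite position-a m | position-b m | centre-low centre = b≮a

  centre-b-last : ∀ {m} → opposite m ≡ m → ∀ l → ¬ position (b m) < position (b l)
  centre-b-last {m} centre l rewrite position-b m | position-b l | centre-low centre
    with low l in low-l
  ... | true  = low-≤-centre centre low-l ∘ b<b⇒<
  ... | false = b≮a

  centre-a-first : ∀ {m} → opposite m ≡ m → ∀ l → ¬ position (a l) < position (a m)
  centre-a-first {m} centre l rewrite position-a m | position-a l | centre-low centre
    with low l in low-l
  ... | true  = low-≤-centre centre low-l ∘ opposite-<⁻¹ ∘ a<a⇒<
  ... | false = b≮a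

  ab-class-separated : ∀ {i j l} → classes (a i) ≡ classes (b j) →
                       ¬ Between (position (a i)) (position (b j)) (position (b l))
  ab-class-separated e with refl , centre ← same-class-ab e =
    [ centre-b-last centre _ ∘ proj₂ , centre-a-before-b centre ∘ proj₂ ]′

  ba-class-separated : ∀ {i j l} → classes (b i) ≡ classes (a j) →
                       ¬ Between (position (b i)) (position (a j)) (position (a l))
  ba-class-separated e with refl , centre ← same-class-ab (sym e) =
    [ centre-a-before-b centre ∘ proj₁ , centre-a-first centre _ ∘ proj₁ ]′

  between-consistent : ∀ p q r → Between (position p) (position q) (position r) →
                       classes p ≡ classes q → Adj (Crown n) p r → Adj (Crown n) q r
  between-consistent p q r btw e pr with view p | view q | view r
  ... | a-view i | a-view j | b-view l =
    ab-edge λ { refl → aa-class-separated e (ab-edge⁻¹ pr) btw }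
  ... | b-view i | b-view j | a-view l =
    ba-edge λ { refl → bb-class-separated e (ba-edge⁻¹ pr) btw }
  ... | a-view i | b-view j | b-view l = ⊥-elim (ab-class-separated e btw)
  ... | b-view i | a-view j | a-view l = ⊥-elim (ba-class-separated e btw)
  ... | a-view i | _        | a-view l = ⊥-elim (aa-non-edge pr)
  ... | b-view i | _        | b-view l = ⊥-elim (bb-non-edge pr)

  crown-pthin : IndPThinWith (Crown n) n
  crown-pthin = classes , ordering , classes-independent ,
                strongly-consistent-between (Crown n) classes ordering between-consistent

  crown-thin : IndThinWith (Crown n) n
  crown-thin with c , π , ind , cons , _ ← crown-pthin = c , π , ind , cons

theorem17 : (n : ℕ) → n ≥ 1 → ThinInd≡ (Crown n) n × PThinInd≡ (Crown n) n
theorem17 n _ = (crown-thin , λ _ → thin-lower-bound) , (crown-pthin , λ _ → pthin-lower-bound)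
  where open CrownProperties n
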